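{- If $p$ is an indecomposable permutation of length $n$, then its normalization $N(p)$ has last entry equal to $n$.
   Context: A permutation $p=(p_1,\dots,p_n)$ is decomposable if there is $1\le m<n$ such that every entry among $p_1,\dots,p_m$ is larger than every entry among $p_{m+1},\dots,p_n$; otherwise it is indecomposable. An entry $p_i$ is a left-to-right minimum if $p_i<p_j$ for all $j<i$. Two permutations of length $n$ are in the same class if they have the same left-to-right minima in the same positions. Each class contains exactly one $132$-avoiding permutation (no indices $i<j<k$ with $p_i<p_k<p_j$); the normalization $N(p)$ is the unique $132$-avoiding permutation in the class of $p$. -}

module Defs where

open import Data.Nat using (ℕ; suc; _≤_; _<_)
open import Data.Fin using (Fin; toℕ) renaming (_<_ to _<ᶠ_)
open import Data.Fin.Permutation using (Permutation′; _⟨$⟩ʳ_)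
open import Data.Product using (Σ; ∃; _×_; _,_)
open import Relation.Nullary using (¬_)
open import Relation.Binary.PropositionalEquality using (_≡_)
open import Function.Bundles using (_⇔_)

-- A permutation of length n is a bijection  Fin n → Fin n ;
-- position i (0-based) holds entry  p ⟨$⟩ʳ i  (0-based value).
-- Entry comparison is the order on Fin (equivalently on toℕ).

Decomposable : {n : ℕ} → Permutation′ n → Set
Decomposable {n} p =
  Σ ℕ λ m → (1 ≤ m) × (m < n) ×
    (∀ (i j : Fin n) → toℕ i < m → m ≤ toℕ j → (p ⟨$⟩ʳ j) <ᶠ (p ⟨$⟩ʳ i))

Indecomposable : {n : ℕ} → Permutation′ n → Set
Indecomposable p = ¬ Decomposable p

LRMin : {n : ℕ} → Permutation′ n → Fin n → Set
LRMin {n} p i = ∀ (j : Fin n) → j <ᶠ i → (p ⟨$⟩ʳ i) <ᶠ (p ⟨$⟩ʳ j)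

SameClass : {n : ℕ} → Permutation′ n → Permutation′ n → Set
SameClass {n} p q =
  ∀ (i : Fin n) → (LRMin p i ⇔ LRMin q i) × (LRMin p i → p ⟨$⟩ʳ i ≡ q ⟨$⟩ʳ i)

Contains132 : {n : ℕ} → Permutation′ n → Set
Contains132 {n} p =
  Σ (Fin n) λ i → Σ (Fin n) λ j → Σ (Fin n) λ k →
    (i <ᶠ j) × (j <ᶠ k) × ((p ⟨$⟩ʳ i) <ᶠ (p ⟨$⟩ʳ k)) × ((p ⟨$⟩ʳ k) <ᶠ (p ⟨$⟩ʳ j))

Avoids132 : {n : ℕ} → Permutation′ n → Set
Avoids132 p = ¬ Contains132 p

-- q is the normalization N(p): the (unique) 132-avoiding permutation in the class of p.
IsNormalization : {n : ℕ} → Permutation′ n → Permutation′ n → Set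
IsNormalization p q = SameClass p q × Avoids132 q

{-# OPTIONS --safe #-}
-- Let k be the position of the largest entry of the normalization q, and v the
-- smallest entry of q among positions 0..k.  Since q avoids 132, every entry of q
-- after position k is below v.  Every entry of p at a position ≤ k dominates some
-- left-to-right minimum of p at or before it, which q shares, so it is ≥ v.  By
-- pigeonhole the first k+1 entries of p are then exactly the values ≥ v, so p
-- splits after position k; indecomposability forces k to be the last position.
module Submission where

open import Defs
open import Data.Nat as ℕ using (ℕ; suc; z≤n; s≤s; s≤s⁻¹)
open import Data.Nat.Properties using (≤-refl; ≤-trans; <-≤-trans; ≤-<-trans; <⇒≤; ≰⇒>; ≮⇒≥; <⇒≱; 1+n≰n; module ≤-Reasoning)
open import Data.Fin using (Fin; zero; suc; toℕ; fromℕ; _≤_; _<_)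
open import Data.Fin.Properties
  using (_≟_; _≤?_; _<?_; toℕ-fromℕ; ≤fromℕ; ≤∧≢⇒<; <⇒≢; injective⇒≤)
open import Data.Fin.Permutation using (Permutation′; _⟨$⟩ʳ_; _⟨$⟩ˡ_; inverseʳ)
open import Data.Product using (∃; _×_; _,_; proj₂)
open import Data.Empty using (⊥-elim)
open import Function using (_∘_)
open import Function.Bundles using (Injection)
open import Function.Definitions using (Injective)
open import Function.Properties.Inverse using (↔⇒↣)
open import Relation.Nullary using (¬_; yes; no; contradiction)
open import Relation.Unary using (Pred; Decidable)
open import Relation.Binary.PropositionalEquality using (_≡_; _≢_; refl; sym; cong; subst)

private
  variable
    m n : ℕ

⟨$⟩ʳ-injective : (π : Permutation′ n) → Injective _≡_ _≡_ (π ⟨$⟩ʳ_)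
⟨$⟩ʳ-injective π = Injection.injective (↔⇒↣ π)

prefix-argmin : (f : Fin n → Fin m) (i : Fin n) →
  ∃ λ a → a ≤ i × (∀ j → j ≤ i → f a ≤ f j)
prefix-argmin f zero = zero , z≤n , λ { zero _ → ≤-refl }
prefix-argmin f (suc i) with prefix-argmin (f ∘ suc) i
... | a , a≤i , a-min with f zero ≤? f (suc a)
...   | yes f0≤fa = zero , z≤n , λ where
        zero    _           → ≤-refl
        (suc j) (s≤s j≤i) → ≤-trans f0≤fa (a-min j j≤i)
...   | no  f0≰fa = suc a , s≤s a≤i , λ where
        zero    _           → <⇒≤ (≰⇒> f0≰fa)
        (suc j) (s≤s j≤i) → a-min j j≤i

lrMin-below : (p : Permutation′ n) (i : Fin n) →
  ∃ λ b → b ≤ i × LRMin p b × (p ⟨$⟩ʳ b) ≤ (p ⟨$⟩ʳ i)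
lrMin-below p i with prefix-argmin (p ⟨$⟩ʳ_) i
... | b , b≤i , b-min = b , b≤i , b-lrMin , b-min i ≤-refl
  where
  b-lrMin : LRMin p b
  b-lrMin j j<b = ≤∧≢⇒< (b-min j (≤-trans (<⇒≤ j<b) b≤i))
                        (<⇒≢ j<b ∘ sym ∘ ⟨$⟩ʳ-injective p)

entry<max : (π : Permutation′ (suc n)) → ∀ {j k} →
  π ⟨$⟩ʳ k ≡ fromℕ n → j ≢ k → (π ⟨$⟩ʳ j) < (π ⟨$⟩ʳ k)
entry<max π {j} πk≡max j≢k =
  ≤∧≢⇒< (subst ((π ⟨$⟩ʳ j) ≤_) (sym πk≡max) (≤fromℕ _)) (j≢k ∘ ⟨$⟩ʳ-injective π)

avoids132⇒after-max<before-max : (q : Permutation′ (suc n)) → Avoids132 q →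
  ∀ {a k l} → q ⟨$⟩ʳ k ≡ fromℕ n → a ≤ k → k < l → (q ⟨$⟩ʳ l) < (q ⟨$⟩ʳ a)
avoids132⇒after-max<before-max q avoid {a} {k} {l} qk≡max a≤k k<l with a ≟ k
... | yes refl = entry<max q qk≡max (<⇒≢ k<l ∘ sym)
... | no a≢k with (q ⟨$⟩ʳ l) <? (q ⟨$⟩ʳ a)
...   | yes ql<qa = ql<qa
...   | no  ql≮qa =
  contradiction (a , k , l , ≤∧≢⇒< a≤k a≢k , k<l , qa<ql , entry<max q qk≡max (<⇒≢ k<l ∘ sym)) avoid
  where
  qa<ql : (q ⟨$⟩ʳ a) < (q ⟨$⟩ʳ l)
  qa<ql = ≤∧≢⇒< (≮⇒≥ ql≮qa) (<⇒≢ (≤-<-trans a≤k k<l) ∘ ⟨$⟩ʳ-injective q)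

-- Gluing f on P to g off P is an injection of Fin n into itself that never takes
-- a value f j with j ∉ P and v ≤ f j; adding that value would inject Fin (suc n).
module _ {ℓ} {P : Pred (Fin n) ℓ} (P? : Decidable P)
         {f g : Fin n → Fin n} (f-injective : Injective _≡_ _≡_ f) (g-injective : Injective _≡_ _≡_ g)
         {v : Fin n} (f≥v : ∀ {x} → P x → v ≤ f x) (g<v : ∀ {y} → ¬ P y → g y < v)
         where

  private
    separated : ∀ {x y} → v ≤ f x → g y < v → f x ≢ g y
    separated v≤fx gy<v fx≡gy = <⇒≢ (<-≤-trans gy<v v≤fx) (sym fx≡gy)

    glue : Fin n → Fin n
    glue x with P? x
    ... | yes _ = f x
    ... | no  _ = g x

    glue-injective : Injective _≡_ _≡_ glue
    glue-injective {x} {y} with P? x | P? y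
    ... | yes  _  | yes  _  = f-injective
    ... | no  ¬Px | no  ¬Py = g-injective
    ... | yes Px  | no  ¬Py = ⊥-elim ∘ separated (f≥v Px) (g<v ¬Py)
    ... | no  ¬Px | yes Py  = ⊥-elim ∘ separated (f≥v Py) (g<v ¬Px) ∘ sym

  threshold-pigeonhole : ∀ {j} → ¬ P j → f j < v
  threshold-pigeonhole {j} ¬Pj with v ≤? f j
  ... | no  v≰fj = ≰⇒> v≰fj
  ... | yes v≤fj = contradiction (injective⇒≤ extended-injective) 1+n≰n
    where
    fj≢glue : ∀ x → f j ≢ glue x
    fj≢glue x with P? x
    ... | yes Px  = λ fj≡fx → ¬Pj (subst P (sym (f-injective fj≡fx)) Px)
    ... | no  ¬Px = separated v≤fj (g<v ¬Px)

    extended : Fin (suc n) → Fin n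
    extended zero    = f j
    extended (suc x) = glue x

    extended-injective : Injective _≡_ _≡_ extended
    extended-injective {zero}  {zero}  _ = refl
    extended-injective {zero}  {suc y} e = ⊥-elim (fj≢glue y e)
    extended-injective {suc x} {zero}  e = ⊥-elim (fj≢glue x (sym e))
    extended-injective {suc x} {suc y} e = cong suc (glue-injective e)

normalization-splits-after-max : (p q : Permutation′ (suc n)) → IsNormalization p q →
  ∀ {k} → q ⟨$⟩ʳ k ≡ fromℕ n → ∀ {i j} → i ≤ k → k < j → (p ⟨$⟩ʳ j) < (p ⟨$⟩ʳ i)
normalization-splits-after-max p q (same , avoid) {k} qk≡max i≤k k<j
  with prefix-argmin (q ⟨$⟩ʳ_) k
... | a , a≤k , a-min = <-≤-trans (p-suffix (<⇒≱ k<j)) (p-prefix i≤k)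
  where
  p-prefix : ∀ {x} → x ≤ k → (q ⟨$⟩ʳ a) ≤ (p ⟨$⟩ʳ x)
  p-prefix {x} x≤k with lrMin-below p x
  ... | b , b≤x , b-lrMin , pb≤px = begin
    toℕ (q ⟨$⟩ʳ a)  ≤⟨ a-min b (≤-trans b≤x x≤k) ⟩
    toℕ (q ⟨$⟩ʳ b)  ≡⟨ cong toℕ (sym (proj₂ (same b) b-lrMin)) ⟩
    toℕ (p ⟨$⟩ʳ b)  ≤⟨ pb≤px ⟩
    toℕ (p ⟨$⟩ʳ x)  ∎
    where open ≤-Reasoning

  q-suffix : ∀ {y} → ¬ y ≤ k → (q ⟨$⟩ʳ y) < (q ⟨$⟩ʳ a)
  q-suffix y≰k = avoids132⇒after-max<before-max q avoid qk≡max a≤k (≰⇒> y≰k)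

  p-suffix : ∀ {y} → ¬ y ≤ k → (p ⟨$⟩ʳ y) < (q ⟨$⟩ʳ a)
  p-suffix = threshold-pigeonhole (_≤? k) (⟨$⟩ʳ-injective p) (⟨$⟩ʳ-injective q) p-prefix q-suffix

mainTheorem5 : (n : ℕ) (p q : Permutation′ (suc n)) →
    Indecomposable p → IsNormalization p q →
    q ⟨$⟩ʳ fromℕ n ≡ fromℕ n
mainTheorem5 n p q indec normal with q ⟨$⟩ˡ fromℕ n ≟ fromℕ n
... | yes k≡last = subst (λ x → q ⟨$⟩ʳ x ≡ fromℕ n) k≡last (inverseʳ q)
... | no  k≢last = ⊥-elim (indec (suc (toℕ k) , s≤s z≤n , s≤s k<last , split))
  where
  k : Fin (suc n)
  k = q ⟨$⟩ˡ fromℕ n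

  k<last : toℕ k ℕ.< n
  k<last = subst (toℕ k ℕ.<_) (toℕ-fromℕ n) (≤∧≢⇒< (≤fromℕ k) k≢last)

  split : ∀ i j → toℕ i ℕ.< suc (toℕ k) → suc (toℕ k) ℕ.≤ toℕ j → (p ⟨$⟩ʳ j) < (p ⟨$⟩ʳ i)
  split i j i≤k k<j = normalization-splits-after-max p q normal (inverseʳ q) (s≤s⁻¹ i≤k) k<j
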